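{- Let $\Theta_5^{\#1}$ be the 2-cell embedding of $\Theta_5$ on the double torus given by the rotation system $u:(1,2,3,4,5)$, $v:(1,2,4,5,3)$, where $1,\dots,5$ are the five edges. Then the automorphism group of $\Theta_5^{\#1}$ has order two, and $\Theta_5^{\#1}$ is non-orientable.
   Context: $\Theta_5$ is the multigraph with two vertices $u,v$ and five parallel edges $1,2,3,4,5$ between them. A 2-cell embedding of a multigraph on an orientable surface is given by a rotation system: for each vertex a cyclic ordering of its incident edges. An automorphism of an embedding is a permutation of the vertices and/or edges (preserving incidence) that leaves the rotation system unchanged. An embedding is called non-orientable if the embedding obtained by reversing all rotations is isomorphic to the original (i.e. some permutation of vertices and edges transforms one rotation system into the other), and orientable otherwise. -}

module Defs where

open import Data.Nat using (ℕ; _+_)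
open import Data.Nat.DivMod using (_mod_)
open import Data.Fin using (Fin; toℕ; opposite; zero; suc)
open import Data.Fin.Permutation using (Permutation′; _⟨$⟩ʳ_; _⟨$⟩ˡ_)
open import Data.Product using (Σ; ∃; _×_; _,_; proj₁; proj₂)
open import Relation.Binary.PropositionalEquality using (_≡_)

-- Θ₅: vertices Fin 2 (u = zero, v = suc zero); edges Fin 5
-- (edge k of the paper is the Fin 5 element with toℕ = k - 1).
-- Every edge joins u and v, so any pair of a vertex permutation and an
-- edge permutation preserves incidence.
Vertex : Set
Vertex = Fin 2

Edge : Set
Edge = Fin 5

-- A cyclic ordering of the five edges at a vertex, written as a sequence
-- (position ↦ edge), considered up to cyclic shift.
CyclicSeq : Set
CyclicSeq = Fin 5 → Edge

_≈ᶜ_ : CyclicSeq → CyclicSeq → Set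
a ≈ᶜ b = ∃ λ (k : Fin 5) → ∀ (i : Fin 5) → b i ≡ a ((toℕ i + toℕ k) mod 5)

RotationSystem : Set
RotationSystem = Vertex → CyclicSeq

_≈ᴿ_ : RotationSystem → RotationSystem → Set
R ≈ᴿ R′ = ∀ (x : Vertex) → R x ≈ᶜ R′ x

act : Permutation′ 2 → Permutation′ 5 → RotationSystem → RotationSystem
act σ τ R y i = τ ⟨$⟩ʳ R (σ ⟨$⟩ˡ y) i

reverseRS : RotationSystem → RotationSystem
reverseRS R x i = R x (opposite i)

_≅_ : RotationSystem → RotationSystem → Set
R ≅ R′ = ∃ λ (σ : Permutation′ 2) → ∃ λ (τ : Permutation′ 5) → act σ τ R ≈ᴿ R′

Automorphism : RotationSystem → Set
Automorphism R = Σ (Permutation′ 2 × Permutation′ 5) λ p → act (proj₁ p) (proj₂ p) R ≈ᴿ R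

_≈ᴬ_ : ∀ {R} → Automorphism R → Automorphism R → Set
a ≈ᴬ b = (∀ x → proj₁ (proj₁ a) ⟨$⟩ʳ x ≡ proj₁ (proj₁ b) ⟨$⟩ʳ x)
       × (∀ e → proj₂ (proj₁ a) ⟨$⟩ʳ e ≡ proj₂ (proj₁ b) ⟨$⟩ʳ e)

NonOrientable : RotationSystem → Set
NonOrientable R = R ≅ reverseRS R

e1 e2 e3 e4 e5 : Edge
e1 = zero
e2 = suc zero
e3 = suc (suc zero)
e4 = suc (suc (suc zero))
e5 = suc (suc (suc (suc zero)))

seqOf : Edge → Edge → Edge → Edge → Edge → CyclicSeq
seqOf a b c d e zero = a
seqOf a b c d e (suc zero) = b
seqOf a b c d e (suc (suc zero)) = c
seqOf a b c d e (suc (suc (suc zero))) = d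
seqOf a b c d e (suc (suc (suc (suc zero)))) = e

Theta5#1 : RotationSystem
Theta5#1 zero = seqOf e1 e2 e3 e4 e5
Theta5#1 (suc zero) = seqOf e1 e2 e4 e5 e3

-- An automorphism (σ, τ) is determined by σ together with the cyclic shift k₀ by
-- which τ matches the rotation at u to the rotation at σ⁻¹ u: that rotation meets
-- every edge, so it fixes τ.  Requiring that the resulting τ also carries the
-- rotation at σ⁻¹ v to a shift k₁ of the rotation at v is a condition on the finite
-- data (σ⁻¹ u, σ⁻¹ v, k₀, k₁); checking it for all 2 · 2 · 5 · 5 choices leaves only
-- the identity and the automorphism exchanging u and v with edge permutation
-- (1 4)(2 5).  Non-orientability is witnessed by the edge permutation (1 5)(2 4),
-- which maps each rotation to a shift of its reverse.
module Submission where

open import Data.Fin using (Fin; zero; suc; toℕ; _≟_)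
open import Data.Fin.Permutation
  using (Permutation′; _⟨$⟩ʳ_; _⟨$⟩ˡ_; inverseˡ; inverseʳ; id; reverse; transpose; _∘ₚ_)
open import Data.Nat using (_+_)
open import Data.Nat.DivMod using (_mod_)
open import Data.Fin.Properties using (all?; any?; 0≢1+n)
open import Data.Product using (∃; _×_; _,_; proj₁; proj₂)
open import Data.Sum using (_⊎_; inj₁; inj₂)
open import Function using (_∘_)
open import Function.Definitions using (StrictlySurjective)
open import Relation.Binary.PropositionalEquality
  using (_≡_; _≗_; refl; sym; trans; cong; cong₂)
open import Relation.Nullary using (¬_; Dec)
open import Relation.Nullary.Decidable using (_×-dec_; _⊎-dec_; _→-dec_; from-yes)

open import Defs

∘-cancelʳ-surjective : ∀ {A B C : Set} {a : A → B} (t t′ : B → C) →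
                       StrictlySurjective _≡_ a → (∀ i → t (a i) ≡ t′ (a i)) → t ≗ t′
∘-cancelʳ-surjective t t′ surj agree e with surj e
... | i , refl = agree i

⟨$⟩ˡ-≗⇒⟨$⟩ʳ-≗ : ∀ {n} (π ρ : Permutation′ n) →
                 (∀ x → π ⟨$⟩ˡ x ≡ ρ ⟨$⟩ˡ x) → ∀ x → π ⟨$⟩ʳ x ≡ ρ ⟨$⟩ʳ x
⟨$⟩ˡ-≗⇒⟨$⟩ʳ-≗ π ρ same x =
  trans (cong (π ⟨$⟩ʳ_) (trans (sym (inverseˡ ρ)) (sym (same (ρ ⟨$⟩ʳ x))))) (inverseʳ π)

u v : Vertex
u = zero
v = suc zero

rotate : Fin 5 → CyclicSeq → CyclicSeq
rotate k a i = a ((toℕ i + toℕ k) mod 5)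

_≈ᶜ?_ : (a b : CyclicSeq) → Dec (a ≈ᶜ b)
a ≈ᶜ? b = any? λ k → all? λ i → b i ≟ rotate k a i

_≈ᴿ?_ : (R R′ : RotationSystem) → Dec (R ≈ᴿ R′)
R ≈ᴿ? R′ = all? λ x → R x ≈ᶜ? R′ x

module Automorphisms (R : RotationSystem) where

  vertexPerm : Automorphism R → Permutation′ 2
  vertexPerm = proj₁ ∘ proj₁

  edgePerm : Automorphism R → Permutation′ 5
  edgePerm = proj₂ ∘ proj₁

  source : Automorphism R → Vertex → Vertex
  source c y = vertexPerm c ⟨$⟩ˡ y

  shift : Automorphism R → Vertex → Fin 5
  shift c y = proj₁ (proj₂ c y)

  rotation-preserved : (c : Automorphism R) (y : Vertex) →
                       R y ≗ (edgePerm c ⟨$⟩ʳ_) ∘ rotate (shift c y) (R (source c y))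
  rotation-preserved c y = proj₂ (proj₂ c y)

  ≈ᴬ-intro : (a b : Automorphism R) (y : Vertex) →
             (∀ x → source a x ≡ source b x) → shift a y ≡ shift b y →
             StrictlySurjective _≡_ (rotate (shift a y) (R (source a y))) → a ≈ᴬ b
  ≈ᴬ-intro a b y same-source same-shift surj =
    ⟨$⟩ˡ-≗⇒⟨$⟩ʳ-≗ (vertexPerm a) (vertexPerm b) same-source ,
    ∘-cancelʳ-surjective (edgePerm a ⟨$⟩ʳ_) (edgePerm b ⟨$⟩ʳ_) surj λ i →
      trans (sym (rotation-preserved a y i))
            (trans (rotation-preserved b y i)
                   (cong (edgePerm b ⟨$⟩ʳ_)
                         (cong₂ (λ k w → rotate k (R w) i) (sym same-shift) (sym (same-source y)))))

  -- A necessary condition on the data (σ⁻¹ u, σ⁻¹ v, k₀, k₁) of an automorphism that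
  -- no longer mentions its edge permutation.
  Compatible : Vertex → Vertex → Fin 5 → Fin 5 → Set
  Compatible w₀ w₁ k₀ k₁ = ∀ i j → rotate k₁ (R w₁) i ≡ rotate k₀ (R w₀) j → R v i ≡ R u j

  compatible? : ∀ w₀ w₁ k₀ k₁ → Dec (Compatible w₀ w₁ k₀ k₁)
  compatible? w₀ w₁ k₀ k₁ = all? λ i → all? λ j →
    (rotate k₁ (R w₁) i ≟ rotate k₀ (R w₀) j) →-dec (R v i ≟ R u j)

  automorphism-compatible : (c : Automorphism R) →
    Compatible (source c u) (source c v) (shift c u) (shift c v)
  automorphism-compatible c i j same-edge =
    trans (rotation-preserved c v i)
          (trans (cong (edgePerm c ⟨$⟩ʳ_) same-edge) (sym (rotation-preserved c u j)))

open Automorphisms Theta5#1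

rotations-surjective : ∀ w k → StrictlySurjective _≡_ (rotate k (Theta5#1 w))
rotations-surjective = from-yes (all? λ w → all? λ k → all? λ e → any? λ i → rotate k (Theta5#1 w) i ≟ e)

-- Kept opaque so that the with in classify does not try to normalise the decision.
opaque
  compatible-cases : ∀ w₀ w₁ k₀ k₁ → Compatible w₀ w₁ k₀ k₁ →
                     (w₀ ≡ u × w₁ ≡ v × k₀ ≡ zero) ⊎ (w₀ ≡ v × w₁ ≡ u × k₀ ≡ suc (suc zero))
  compatible-cases = from-yes (all? λ w₀ → all? λ w₁ → all? λ k₀ → all? λ k₁ →
    compatible? w₀ w₁ k₀ k₁ →-dec
      ((w₀ ≟ u ×-dec w₁ ≟ v ×-dec k₀ ≟ zero) ⊎-dec (w₀ ≟ v ×-dec w₁ ≟ u ×-dec k₀ ≟ suc (suc zero))))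

identityᴬ : Automorphism Theta5#1
identityᴬ = (id , id) , from-yes (act id id Theta5#1 ≈ᴿ? Theta5#1)

flipᴬ : Automorphism Theta5#1
flipᴬ = (reverse , transpose e1 e4 ∘ₚ transpose e2 e5) ,
        from-yes (act reverse (transpose e1 e4 ∘ₚ transpose e2 e5) Theta5#1 ≈ᴿ? Theta5#1)

identity≉flip : ¬ (identityᴬ ≈ᴬ flipᴬ)
identity≉flip (_ , same-edges) = 0≢1+n (same-edges e1)

classify : (c : Automorphism Theta5#1) → c ≈ᴬ identityᴬ ⊎ c ≈ᴬ flipᴬ
classify c with compatible-cases _ _ _ _ (automorphism-compatible c)
... | inj₁ (w₀≡u , w₁≡v , k₀≡0) =
  inj₁ (≈ᴬ-intro c identityᴬ u (λ { zero → w₀≡u ; (suc zero) → w₁≡v }) k₀≡0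
               (rotations-surjective (source c u) (shift c u)))
... | inj₂ (w₀≡v , w₁≡u , k₀≡2) =
  inj₂ (≈ᴬ-intro c flipᴬ u (λ { zero → w₀≡v ; (suc zero) → w₁≡u }) k₀≡2
               (rotations-surjective (source c u) (shift c u)))

lemma2 : (∃ λ (a : Automorphism Theta5#1) → ∃ λ (b : Automorphism Theta5#1) →
           (¬ (a ≈ᴬ b)) × (∀ (c : Automorphism Theta5#1) → (c ≈ᴬ a) ⊎ (c ≈ᴬ b)))
         × NonOrientable Theta5#1
lemma2 = (identityᴬ , flipᴬ , identity≉flip , classify)
       , id , reverse , from-yes (act id reverse Theta5#1 ≈ᴿ? reverseRS Theta5#1)
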